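{- For every integer $d \ge 1$, every graph that does not contain the complete graph $K_d$ as a minor has distance $2$VC-dimension at most $d-1$.
   Context: All graphs are finite and simple. For a graph $G=(V,E)$ and vertices $x,y$, $d_G(x,y)$ is the length of a shortest $xy$-path ($+\infty$ if none), and $B_G(x,k)=\{y\in V: d_G(x,y)\le k\}$ is the ball of center $x$ and radius $k$. The $B$-hypergraph of $G$ has vertex set $V$ and hyperedges all balls $B_G(v,k)$ for $v\in V$ and integers $k\ge 0$. In a hypergraph, a set $X$ of vertices is $2$-shattered if for every subset $X'\subseteq X$ with $|X'|=2$ there is a hyperedge $e$ with $e\cap X=X'$; the $2$VC-dimension of the hypergraph is the maximum size of a $2$-shattered set. The distance $2$VC-dimension of a graph $G$ is the maximum, over all induced subgraphs $G'$ of $G$, of the $2$VC-dimension of the $B$-hypergraph of $G'$ (distances computed in $G'$). A graph $H$ is a minor of $G$ if $H$ can be obtained from $G$ by deleting vertices, deleting edges and contracting edges. -}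

module Defs where

open import Level using (Level)
open import Data.Nat using (ℕ; zero; suc; _≤_)
open import Data.Fin using (Fin; punchIn)
open import Data.Product using (Σ; _×_; _,_)
open import Data.Sum using (_⊎_)
open import Relation.Nullary using (¬_)
open import Relation.Binary.PropositionalEquality using (_≡_; _≢_)
open import Function.Bundles using (_⇔_)
open import Function.Definitions using (Injective)

record Graph (n : ℕ) : Set₁ where
  field
    Adj     : Fin n → Fin n → Set
    sym     : ∀ {x y} → Adj x y → Adj y x
    irrefl  : ∀ {x} → ¬ Adj x x
open Graph public

data Walk {n : ℕ} (G : Graph n) : Fin n → Fin n → ℕ → Set where
  [] : ∀ {x} → Walk G x x zero
  _∷_ : ∀ {x y z j} → Adj G x y → Walk G y z j → Walk G x z (suc j)

-- d_G(x,y) ≤ k  (false when d_G(x,y) = +∞): some xy-walk (equivalently a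
-- shortest xy-path) has length at most k.
DistLe : {n : ℕ} → Graph n → Fin n → Fin n → ℕ → Set
DistLe G x y k = Σ ℕ λ j → j ≤ k × Walk G x y j

InBall : {n : ℕ} → Graph n → Fin n → ℕ → Fin n → Set
InBall G v k y = DistLe G v y k

-- Induced subgraphs: G' (on Fin m) is (isomorphic to) the subgraph of G
-- induced by the image of an injective map f : Fin m → Fin n.
InducedSubgraph : {m n : ℕ} → Graph m → Graph n → Set
InducedSubgraph {m} {n} G' G =
  Σ (Fin m → Fin n) λ f →
    Injective _≡_ _≡_ f × (∀ x y → Adj G' x y ⇔ Adj G (f x) (f y))

-- The set X is given as an injective enumeration X : Fin k → Fin n
-- (so |X| = k).
TwoShattered : {n k : ℕ} → Graph n → (Fin k → Fin n) → Set
TwoShattered {n} {k} G X =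
  ∀ (i j : Fin k) → i ≢ j →
    Σ (Fin n) λ v → Σ ℕ λ r →
      ∀ (l : Fin k) → InBall G v r (X l) ⇔ (l ≡ i ⊎ l ≡ j)

DeleteVertex : {n : ℕ} → Graph n → Graph (suc n) → Set
DeleteVertex {n} H G =
  Σ (Fin (suc n)) λ v →
    ∀ (x y : Fin n) → Adj H x y ⇔ Adj G (punchIn v x) (punchIn v y)

DeleteEdge : {n : ℕ} → Graph n → Graph n → Set
DeleteEdge {n} H G =
  Σ (Fin n) λ u → Σ (Fin n) λ v → Adj G u v ×
    (∀ (x y : Fin n) → Adj H x y ⇔
       (Adj G x y × ¬ ((x ≡ u × y ≡ v) ⊎ (x ≡ v × y ≡ u))))

-- H is obtained from G by contracting the edge uv: vertex v is removed and
-- u (which is punchIn v u' in G, u' in H) becomes adjacent to every other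
-- neighbour of v.
ContractEdge : {n : ℕ} → Graph n → Graph (suc n) → Set
ContractEdge {n} H G =
  Σ (Fin (suc n)) λ v → Σ (Fin n) λ u' → Adj G (punchIn v u') v ×
    (∀ (x y : Fin n) → Adj H x y ⇔
       (x ≢ y ×
         (Adj G (punchIn v x) (punchIn v y)
          ⊎ (x ≡ u' × Adj G v (punchIn v y))
          ⊎ (y ≡ u' × Adj G v (punchIn v x)))))

data IsMinor : {m n : ℕ} → Graph m → Graph n → Set₁ where
  here   : ∀ {n} {G : Graph n} → IsMinor G G
  delV   : ∀ {m n} {H : Graph m} {K : Graph (suc m)} {G : Graph n} →
           DeleteVertex H K → IsMinor K G → IsMinor H G
  delE   : ∀ {m n} {H K : Graph m} {G : Graph n} →
           DeleteEdge H K → IsMinor K G → IsMinor H G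
  contr  : ∀ {m n} {H : Graph m} {K : Graph (suc m)} {G : Graph n} →
           ContractEdge H K → IsMinor K G → IsMinor H G

IsComplete : {d : ℕ} → Graph d → Set
IsComplete {d} H = ∀ (x y : Fin d) → x ≢ y → Adj H x y

-- G contains K_d as a minor (up to isomorphism, i.e. some minor of G on
-- d vertices is complete).
HasCompleteMinor : (d : ℕ) → {n : ℕ} → Graph n → Set₁
HasCompleteMinor d G = Σ (Graph d) λ H → IsComplete H × IsMinor H G

module Submission where

-- Let X = {X 0, …, X K} be 2-shattered in G′.  The Voronoi cells of X (every
-- vertex joins the cell of its nearest point of X, ties broken by index) are connected, since
-- the next vertex on a shortest path to the centre stays in the cell, and any two cells i, j
-- are adjacent: the ball B(v,r) meeting X exactly in {X i, X j} contains shortest walks from v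
-- to X i and to X j, all of whose vertices lie in cells i or j, and one of these walks leaves
-- the cell of v.  So the cells form a K_{K+1} model in G′, hence in G, which contradicts the
-- hypothesis once K + 1 ≥ d.

open import Defs hiding (sym)
open import Data.Nat using (ℕ; zero; suc; _+_; _∸_; _⊔_; _≤_; _<_; z≤n; s≤s; _≤?_)
import Data.Nat.Properties as ℕ
open import Data.Fin using (Fin; punchIn; punchOut) renaming (zero to fzero; suc to fsuc; _≤_ to _≤ᶠ_)
open import Data.Fin.Properties
  using ( _≟_; any?; ≤-antisym; punchIn-injective; punchIn-punchOut; punchInᵢ≢i
        ; suc-injective; injective⇒≤)
  renaming (≤-reflexive to ≤ᶠ-reflexive)
open import Data.Maybe using (Maybe; just; nothing; maybe; _>>=_)
open import Data.Maybe.Properties using (just-injective)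
open import Data.Product using (Σ; _×_; _,_; proj₁; proj₂)
open import Data.Sum using (_⊎_; inj₁; inj₂)
import Data.Sum as Sum
open import Data.Empty using (⊥-elim)
open import Relation.Nullary using (¬_; Dec; yes; no)
open import Relation.Nullary.Decidable using (_×-dec_; map′; ¬¬-excluded-middle)
open import Relation.Unary using (Decidable)
open import Relation.Binary.PropositionalEquality
  using (_≡_; _≢_; refl; sym; trans; cong; subst; subst₂)
open import Function.Bundles using (_⇔_; mk⇔; Equivalence)
open import Function.Definitions using (Injective)
open import Function.Base using (id)

module _ {n : ℕ} {G : Graph n} where

  _++ᵂ_ : ∀ {x y z i j} → Walk G x y i → Walk G y z j → Walk G x z (i + j)
  [] ++ᵂ W = W
  (e ∷ V) ++ᵂ W = e ∷ (V ++ᵂ W)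

  _∈ᵂ_ : ∀ {x y j} → Fin n → Walk G x y j → Set
  _∈ᵂ_ {x} v [] = v ≡ x
  _∈ᵂ_ {x} v (_ ∷ W) = v ≡ x ⊎ v ∈ᵂ W

  start-∈ᵂ : ∀ {x z j} (W : Walk G x z j) → x ∈ᵂ W
  start-∈ᵂ [] = refl
  start-∈ᵂ (_ ∷ _) = inj₁ refl

  split : ∀ {x y z j} (W : Walk G x z j) → y ∈ᵂ W →
          Σ ℕ λ s → Σ ℕ λ a → Walk G x y s × Walk G y z a × s + a ≡ j
  split [] refl = 0 , 0 , [] , [] , refl
  split (e ∷ W) (inj₁ refl) = 0 , _ , [] , e ∷ W , refl
  split (e ∷ W) (inj₂ y∈W) with split W y∈W
  ... | s , a , V , U , s+a≡j = suc s , a , e ∷ V , U , cong suc s+a≡j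

  crossing : ∀ {P Q : Fin n → Set} {x z j} (W : Walk G x z j) → (∀ y → y ∈ᵂ W → P y ⊎ Q y) →
             P x → ¬ P z → Σ (Fin n) λ a → Σ (Fin n) λ b → P a × Q b × Adj G a b
  crossing [] _ Px ¬Pz = ⊥-elim (¬Pz Px)
  crossing (e ∷ W) covered Px ¬Pz with covered _ (inj₂ (start-∈ᵂ W))
  ... | inj₁ Py = crossing W (λ y y∈W → covered y (inj₂ y∈W)) Py ¬Pz
  ... | inj₂ Qy = _ , _ , Px , Qy , e

  DistLe-zero : ∀ {x y} → DistLe G x y 0 → x ≡ y
  DistLe-zero (zero , _ , []) = refl

  DistLe-mono : ∀ {x y s t} → DistLe G x y s → s ≤ t → DistLe G x y t
  DistLe-mono (j , j≤s , W) s≤t = j , ℕ.≤-trans j≤s s≤t , W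

  _++ᴰ_ : ∀ {x y z s t} → DistLe G x y s → DistLe G y z t → DistLe G x z (s + t)
  (i , i≤s , V) ++ᴰ (j , j≤t , W) = i + j , ℕ.+-mono-≤ i≤s j≤t , V ++ᵂ W

  module _ (adj? : ∀ x y → Dec (Adj G x y)) where
    walk? : ∀ x y j → Dec (Walk G x y j)
    walk? x y zero with x ≟ y
    ... | yes refl = yes []
    ... | no x≢y = no λ { [] → x≢y refl }
    walk? x y (suc j) with any? (λ z → adj? x z ×-dec walk? z y j)
    ... | yes (z , e , W) = yes (e ∷ W)
    ... | no none = no λ { (e ∷ W) → none (_ , e , W) }

    distLe? : ∀ x y t → Dec (DistLe G x y t)
    distLe? x y t = map′ (λ { (j , s≤s j≤t , W) → j , j≤t , W })
                         (λ { (j , j≤t , W) → j , s≤s j≤t , W })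
                         (ℕ.anyUpTo? (walk? x y) (suc t))

-- A model of K_k in G: labelled vertices form k branch sets, each connected because every
-- non-root vertex has a neighbour in its branch set of smaller height, and pairwise adjacent.
record MinorModel {n : ℕ} (G : Graph n) (k : ℕ) : Set where
  field
    label      : Fin n → Maybe (Fin k)
    height     : Fin n → ℕ
    root       : Fin k → Fin n
    root-label : ∀ i → label (root i) ≡ just i
    descend    : ∀ w i → label w ≡ just i → w ≢ root i →
                 Σ (Fin n) λ u → Adj G w u × label u ≡ just i × height u < height w
    touch      : ∀ i j → i ≢ j → Σ (Fin n) λ a → Σ (Fin n) λ b →
                 label a ≡ just i × label b ≡ just j × Adj G a b

module _ {N : ℕ} {G : Graph N} {k : ℕ} (M : MinorModel G k) where
  open MinorModel M

  Labelled : Fin N → Set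
  Labelled z = Σ (Fin k) λ i → label z ≡ just i

  -- A way to pass from G to a graph H: ι maps H into G, and collapse, a left inverse of ι, sends
  -- every labelled vertex of G to a vertex of H of the same label and no larger height, so that
  -- edges of G become edges (or loops) of H.  Deletion and contraction are retractions.
  record Retraction {n : ℕ} (H : Graph n) (ι : Fin n → Fin N) : Set where
    field
      collapse        : ∀ z → Labelled z → Fin n
      collapse-ι      : ∀ x z p → z ≡ ι x → collapse z p ≡ x
      collapse-label  : ∀ z p → label (ι (collapse z p)) ≡ label z
      collapse-height : ∀ z p → height (ι (collapse z p)) ≤ height z
      collapse-adj    : ∀ a b p q → Adj G a b → collapse a p ≢ collapse b q →
                        Adj H (collapse a p) (collapse b q)

  retractModel : ∀ {n} {H : Graph n} {ι : Fin n → Fin N} → Retraction H ι → MinorModel H k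
  retractModel {H = H} {ι} R = record
    { label = λ x → label (ι x)
    ; height = λ x → height (ι x)
    ; root = root′
    ; root-label = λ i → trans (collapse-label (root i) _) (root-label i)
    ; descend = descend′
    ; touch = touch′
    }
    where
    open Retraction R
    root′ : Fin k → Fin _
    root′ i = collapse (root i) (i , root-label i)

    descend′ : ∀ x i → label (ι x) ≡ just i → x ≢ root′ i →
               Σ (Fin _) λ u → Adj H x u × label (ι u) ≡ just i × height (ι u) < height (ι x)
    descend′ x i e x≢root
      with descend (ι x) i e (λ ιx≡root → x≢root (sym (collapse-ι x (root i) _ (sym ιx≡root))))
    ... | u , adj , eu , hu = u′ , adj′ , trans (collapse-label u _) eu , climb
      where
      u′ : Fin _
      u′ = collapse u (i , eu)
      climb : height (ι u′) < height (ι x)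
      climb = ℕ.≤-<-trans (collapse-height u _) hu
      x≡ : collapse (ι x) (i , e) ≡ x
      x≡ = collapse-ι x (ι x) _ refl
      adj′ : Adj H x u′
      adj′ = subst (λ y → Adj H y u′) x≡ (collapse-adj _ _ _ _ adj λ c≡ →
               ℕ.<-irrefl (cong (λ y → height (ι y)) (trans (sym c≡) x≡)) climb)

    touch′ : ∀ i j → i ≢ j → Σ (Fin _) λ a → Σ (Fin _) λ b →
             label (ι a) ≡ just i × label (ι b) ≡ just j × Adj H a b
    touch′ i j i≢j with touch i j i≢j
    ... | a , b , ea , eb , adj =
      collapse a _ , collapse b _ , la , lb ,
      collapse-adj a b _ _ adj λ c≡ →
        i≢j (just-injective (trans (sym la) (trans (cong (λ y → label (ι y)) c≡) lb)))
      where
      la : label (ι (collapse a (i , ea))) ≡ just i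
      la = trans (collapse-label a (i , ea)) ea
      lb : label (ι (collapse b (j , eb))) ≡ just j
      lb = trans (collapse-label b (j , eb)) eb

  root-injective : Injective _≡_ _≡_ root
  root-injective {i} {j} r≡ = just-injective (trans (sym (root-label i)) (trans (cong label r≡) (root-label j)))

  -- A vertex that can be removed: unlabelled, or labelled but not the root of its branch set.
  Spare : Fin N → Set
  Spare w = label w ≡ nothing ⊎ Σ (Fin k) λ i → label w ≡ just i × w ≢ root i

  -- roots are not spare, so spareness is decidable
  root-not-spare : ∀ {w i} → label w ≡ just i → w ≡ root i → ¬ Spare w
  root-not-spare e w≡root (inj₁ e′) with trans (sym e′) e
  ... | ()
  root-not-spare e w≡root (inj₂ (j , e′ , w≢root)) =
    w≢root (subst (λ t → _ ≡ root t) (just-injective (trans (sym e) e′)) w≡root)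

  spare? : ∀ w → Dec (Spare w)
  spare? w = decide (label w) refl
    where
    decide : ∀ l → label w ≡ l → Dec (Spare w)
    decide nothing e = yes (inj₁ e)
    decide (just i) e with w ≟ root i
    ... | yes w≡root = no (root-not-spare e w≡root)
    ... | no w≢root = yes (inj₂ (i , e , w≢root))

  module _ (none : ∀ w → ¬ Spare w) where
    labelled : ∀ w → Σ (Fin k) λ i → label w ≡ just i
    labelled w = decide (label w) refl
      where
      decide : ∀ l → label w ≡ l → Σ (Fin k) λ i → label w ≡ just i
      decide nothing e = ⊥-elim (none w (inj₁ e))
      decide (just i) e = i , e

    is-root : ∀ {w i} → label w ≡ just i → w ≡ root i
    is-root {w} {i} e with w ≟ root i
    ... | yes w≡root = w≡root
    ... | no w≢root = ⊥-elim (none w (inj₂ (i , e , w≢root)))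

    -- hence touch makes G complete
    complete-without-spare : IsComplete G
    complete-without-spare x y x≢y with labelled x | labelled y
    ... | i , ex | j , ey with touch i j (λ { refl → x≢y (trans (is-root ex) (sym (is-root ey))) })
    ... | a , b , ea , eb , adj =
      subst₂ (Adj G) (trans (is-root ea) (sym (is-root ex))) (trans (is-root eb) (sym (is-root ey))) adj

punchOut-unique : ∀ {n} {w z : Fin (suc n)} {x : Fin n} (p : w ≢ z) → z ≡ punchIn w x → punchOut p ≡ x
punchOut-unique {w = w} p z≡ = punchIn-injective w _ _ (trans (punchIn-punchOut p) z≡)

module Deletion {n k : ℕ} {G : Graph (suc n)} (M : MinorModel G k)
                (w : Fin (suc n)) (w-unlabelled : MinorModel.label M w ≡ nothing) where
  open MinorModel M

  H : Graph n
  H = record { Adj = λ x y → Adj G (punchIn w x) (punchIn w y) ; sym = Graph.sym G ; irrefl = Graph.irrefl G }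

  step : DeleteVertex H G
  step = w , λ x y → mk⇔ id id

  w≢labelled : ∀ z → Labelled M z → w ≢ z
  w≢labelled z (i , e) refl with trans (sym w-unlabelled) e
  ... | ()

  retraction : Retraction M H (punchIn w)
  retraction = record
    { collapse = λ z p → punchOut (w≢labelled z p)
    ; collapse-ι = λ x z p → punchOut-unique (w≢labelled z p)
    ; collapse-label = λ z p → cong label (punchIn-punchOut (w≢labelled z p))
    ; collapse-height = λ z p → ℕ.≤-reflexive (cong height (punchIn-punchOut (w≢labelled z p)))
    ; collapse-adj = λ a b p q adj _ →
        subst₂ (Adj G) (sym (punchIn-punchOut (w≢labelled a p))) (sym (punchIn-punchOut (w≢labelled b q))) adj
    }

module Contraction {n k : ℕ} {G : Graph (suc n)} (M : MinorModel G k)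
                   (w : Fin (suc n)) {i : Fin k} (w-label : MinorModel.label M w ≡ just i)
                   (w≢root : w ≢ MinorModel.root M i) where
  open MinorModel M

  parent : Σ (Fin (suc n)) λ u → Adj G w u × label u ≡ just i × height u < height w
  parent = descend w i w-label w≢root

  u : Fin (suc n)
  u = proj₁ parent

  u-adj : Adj G w u
  u-adj = proj₁ (proj₂ parent)

  u-label : label u ≡ just i
  u-label = proj₁ (proj₂ (proj₂ parent))

  u-lower : height u < height w
  u-lower = proj₂ (proj₂ (proj₂ parent))

  w≢u : w ≢ u
  w≢u w≡u = ℕ.<-irrefl (cong height (sym w≡u)) u-lower

  u′ : Fin n
  u′ = punchOut w≢u

  u′-spec : punchIn w u′ ≡ u
  u′-spec = punchIn-punchOut w≢u

  ContractedAdj : Fin n → Fin n → Set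
  ContractedAdj x y = x ≢ y ×
    (Adj G (punchIn w x) (punchIn w y)
     ⊎ (x ≡ u′ × Adj G w (punchIn w y))
     ⊎ (y ≡ u′ × Adj G w (punchIn w x)))

  H : Graph n
  H = record { Adj = ContractedAdj ; sym = symmetric ; irrefl = λ a → proj₁ a refl }
    where
    symmetric : ∀ {x y} → ContractedAdj x y → ContractedAdj y x
    symmetric (x≢y , inj₁ a) = (λ e → x≢y (sym e)) , inj₁ (Graph.sym G a)
    symmetric (x≢y , inj₂ (inj₁ a)) = (λ e → x≢y (sym e)) , inj₂ (inj₂ a)
    symmetric (x≢y , inj₂ (inj₂ a)) = (λ e → x≢y (sym e)) , inj₂ (inj₁ a)

  step : ContractEdge H G
  step = w , u′ , subst (λ t → Adj G t w) (sym u′-spec) (Graph.sym G u-adj) ,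
         λ x y → mk⇔ id id

  contract : Fin (suc n) → Fin n
  contract z with w ≟ z
  ... | yes _ = u′
  ... | no w≢z = punchOut w≢z

  contract-punchIn : ∀ x → contract (punchIn w x) ≡ x
  contract-punchIn x with w ≟ punchIn w x
  ... | yes w≡ = ⊥-elim (punchInᵢ≢i w x (sym w≡))
  ... | no w≢ = punchOut-unique w≢ refl

  contract-label : ∀ z → label (punchIn w (contract z)) ≡ label z
  contract-label z with w ≟ z
  ... | yes refl = trans (cong label u′-spec) (trans u-label (sym w-label))
  ... | no w≢z = cong label (punchIn-punchOut w≢z)

  contract-height : ∀ z → height (punchIn w (contract z)) ≤ height z
  contract-height z with w ≟ z
  ... | yes refl = ℕ.<⇒≤ (subst (λ t → height t < height w) (sym u′-spec) u-lower)
  ... | no w≢z = ℕ.≤-reflexive (cong height (punchIn-punchOut w≢z))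

  contract-adj : ∀ a b → Adj G a b → contract a ≢ contract b → Adj H (contract a) (contract b)
  contract-adj a b adj ca≢cb with w ≟ a | w ≟ b
  ... | yes refl | yes refl = ⊥-elim (Graph.irrefl G adj)
  ... | yes refl | no w≢b = ca≢cb , inj₂ (inj₁ (refl , subst (Adj G w) (sym (punchIn-punchOut w≢b)) adj))
  ... | no w≢a | yes refl =
    ca≢cb , inj₂ (inj₂ (refl , subst (Adj G w) (sym (punchIn-punchOut w≢a)) (Graph.sym G adj)))
  ... | no w≢a | no w≢b =
    ca≢cb , inj₁ (subst₂ (Adj G) (sym (punchIn-punchOut w≢a)) (sym (punchIn-punchOut w≢b)) adj)

  retraction : Retraction M H (punchIn w)
  retraction = record
    { collapse = λ z _ → contract z
    ; collapse-ι = λ { x _ _ refl → contract-punchIn x }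
    ; collapse-label = λ z _ → contract-label z
    ; collapse-height = λ z _ → contract-height z
    ; collapse-adj = λ a b _ _ → contract-adj a b
    }

LargeCompleteMinor : ∀ {n₀} → ℕ → Graph n₀ → Set₁
LargeCompleteMinor k G₀ = Σ ℕ λ m → Σ (Graph m) λ H → IsComplete H × IsMinor H G₀ × k ≤ m

-- Remove spare vertices one at a time (deleting or contracting them) until none is left.
model⇒minor : ∀ {n₀} {G₀ : Graph n₀} n {G : Graph n} {k} → MinorModel G k → IsMinor G G₀ →
              LargeCompleteMinor k G₀
model⇒minor n {G} M G≼G₀ with any? (spare? M)
... | no none =
  n , G , complete-without-spare M (λ w s → none (w , s)) , G≼G₀ , injective⇒≤ (root-injective M)
model⇒minor (suc n) M G≼G₀ | yes (w , inj₁ unlabelled) =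
  model⇒minor n (retractModel M (Deletion.retraction M w unlabelled))
    (delV (Deletion.step M w unlabelled) G≼G₀)
model⇒minor (suc n) M G≼G₀ | yes (w , inj₂ (i , e , w≢root)) =
  model⇒minor n (retractModel M (Contraction.retraction M w e w≢root))
    (contr (Contraction.step M w e w≢root) G≼G₀)

shrink : ∀ {n₀} {G₀ : Graph n₀} d m (H : Graph m) → IsComplete H → IsMinor H G₀ → d ≤ m →
         HasCompleteMinor d G₀
shrink d m H complete H≼G₀ d≤m with d ℕ.≟ m
... | yes refl = H , complete , H≼G₀
shrink d zero H complete H≼G₀ z≤n | no d≢m = ⊥-elim (d≢m refl)
shrink d (suc m) H complete H≼G₀ d≤m | no d≢m =
  shrink d m H⁻ (λ x y x≢y → complete (fsuc x) (fsuc y) (λ e → x≢y (suc-injective e)))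
    (delV (fzero , λ x y → mk⇔ id id) H≼G₀) (ℕ.≤-pred (ℕ.≤∧≢⇒< d≤m d≢m))
  where
  H⁻ : Graph m
  H⁻ = record { Adj = λ x y → Adj H (fsuc x) (fsuc y) ; sym = Graph.sym H ; irrefl = Graph.irrefl H }

model⇒completeMinor : ∀ d {n} {G : Graph n} {k} → MinorModel G k → d ≤ k → HasCompleteMinor d G
model⇒completeMinor d {n} M d≤k with model⇒minor n M here
... | m , H , complete , H≼G , k≤m = shrink d m H complete H≼G (ℕ.≤-trans d≤k k≤m)

-- A model in an induced subgraph G′ of G is a model in G (vertices outside G′ stay unlabelled).
module _ {m n : ℕ} {G′ : Graph m} {G : Graph n} (G′⊆G : InducedSubgraph G′ G) where
  private
    f : Fin m → Fin n
    f = proj₁ G′⊆G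
    f-injective : Injective _≡_ _≡_ f
    f-injective = proj₁ (proj₂ G′⊆G)
    f-adj : ∀ x y → Adj G′ x y ⇔ Adj G (f x) (f y)
    f-adj = proj₂ (proj₂ G′⊆G)

  preimage : Fin n → Maybe (Fin m)
  preimage w with any? (λ x → f x ≟ w)
  ... | yes (x , _) = just x
  ... | no _ = nothing

  preimage-f : ∀ x → preimage (f x) ≡ just x
  preimage-f x with any? (λ y → f y ≟ f x)
  ... | yes (y , fy≡fx) = cong just (f-injective fy≡fx)
  ... | no none = ⊥-elim (none (x , refl))

  extendModel : ∀ {k} → MinorModel G′ k → MinorModel G k
  extendModel {k} M = record
    { label = label↑
    ; height = height↑
    ; root = λ i → f (root i)
    ; root-label = λ i → trans (label↑-f (root i)) (root-label i)
    ; descend = descend↑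
    ; touch = λ i j i≢j → let (a , b , ea , eb , adj) = touch i j i≢j in
        f a , f b , trans (label↑-f a) ea , trans (label↑-f b) eb , Equivalence.to (f-adj a b) adj
    }
    where
    open MinorModel M
    label↑ : Fin n → Maybe (Fin k)
    label↑ w = preimage w >>= label
    height↑ : Fin n → ℕ
    height↑ w = maybe height 0 (preimage w)

    label↑-f : ∀ x → label↑ (f x) ≡ label x
    label↑-f x rewrite preimage-f x = refl
    height↑-f : ∀ x → height↑ (f x) ≡ height x
    height↑-f x rewrite preimage-f x = refl

    in-image : ∀ w {i} → label↑ w ≡ just i → Σ (Fin m) λ x → f x ≡ w
    in-image w e with any? (λ x → f x ≟ w)
    ... | yes (x , fx≡w) = x , fx≡w
    ... | no _ with e
    ...   | ()

    descend↑ : ∀ w i → label↑ w ≡ just i → w ≢ f (root i) →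
               Σ (Fin n) λ u → Adj G w u × label↑ u ≡ just i × height↑ u < height↑ w
    descend↑ w i e w≢root with in-image w e
    ... | x , refl with descend x i (trans (sym (label↑-f x)) e) (λ x≡root → w≢root (cong f x≡root))
    ...   | u , adj , eu , hu =
      f u , Equivalence.to (f-adj x u) adj , trans (label↑-f u) eu ,
      subst₂ _<_ (sym (height↑-f u)) (sym (height↑-f x)) hu

-- least P? B is the least t ≤ B with P t, or suc B if there is none; it is used to compute
-- distances, which are not computable for unbounded search.
least : ∀ {P : ℕ → Set} → Decidable P → ℕ → ℕ
least P? B with P? 0
... | yes _ = 0
least P? zero | no _ = 1
least P? (suc B) | no _ = suc (least (λ t → P? (suc t)) B)

least-≤ : ∀ {P : ℕ → Set} (P? : Decidable P) B → least P? B ≤ suc B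
least-≤ P? B with P? 0
... | yes _ = z≤n
least-≤ P? zero | no _ = s≤s z≤n
least-≤ P? (suc B) | no _ = s≤s (least-≤ (λ t → P? (suc t)) B)

least-holds : ∀ {P : ℕ → Set} (P? : Decidable P) B → least P? B ≤ B → P (least P? B)
least-holds P? B _ with P? 0
... | yes P0 = P0
least-holds P? zero () | no _
least-holds P? (suc B) (s≤s ≤B) | no _ = least-holds (λ t → P? (suc t)) B ≤B

least-minimal : ∀ {P : ℕ → Set} (P? : Decidable P) B t → t ≤ B → P t → least P? B ≤ t
least-minimal P? B t _ Pt with P? 0
... | yes _ = z≤n
least-minimal P? B zero _ P0 | no ¬P0 = ⊥-elim (¬P0 P0)
least-minimal P? (suc B) (suc t) (s≤s t≤B) Pt | no _ = s≤s (least-minimal (λ t → P? (suc t)) B t t≤B Pt)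

-- dist x y is d_G(x,y) when that is at most B, and suc B otherwise.
module TruncatedDistance {n : ℕ} (G : Graph n) (adj? : ∀ x y → Dec (Adj G x y)) (B : ℕ) where

  dist : Fin n → Fin n → ℕ
  dist x y = least (distLe? {G = G} adj? x y) B

  dist-≤ : ∀ x y → dist x y ≤ suc B
  dist-≤ x y = least-≤ (distLe? {G = G} adj? x y) B

  dist-walk : ∀ x y → dist x y ≤ B → DistLe G x y (dist x y)
  dist-walk x y = least-holds (distLe? {G = G} adj? x y) B

  dist-minimal : ∀ x y t → t ≤ B → DistLe G x y t → dist x y ≤ t
  dist-minimal x y = least-minimal (distLe? {G = G} adj? x y) B

  dist-self : ∀ x → dist x x ≡ 0
  dist-self x = ℕ.n≤0⇒n≡0 (dist-minimal x x 0 z≤n (0 , z≤n , [] {G = G}))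

  dist-zero : ∀ x y → dist x y ≡ 0 → x ≡ y
  dist-zero x y d≡0 = DistLe-zero (subst (DistLe G x y) d≡0 (dist-walk x y (subst (_≤ B) (sym d≡0) z≤n)))

  dist-step : ∀ x u y → Adj G x u → dist x y ≤ suc (dist u y)
  dist-step x u y e with suc (dist u y) ≤? B
  ... | no ≰B = ℕ.≤-trans (dist-≤ x y) (s≤s (ℕ.≤-pred (ℕ.≰⇒> ≰B)))
  ... | yes ≤B with dist-walk u y (ℕ.≤-trans (ℕ.n≤1+n _) ≤B)
  ...   | j , j≤d , W = dist-minimal x y _ ≤B (suc j , s≤s j≤d , e ∷ W)

IsFirstMin : ∀ {K} → (Fin K → ℕ) → Fin K → Set
IsFirstMin f i = (∀ l → f i ≤ f l) × (∀ l → f l ≤ f i → i ≤ᶠ l)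

firstMin-unique : ∀ {K} {f : Fin K → ℕ} {i j} → IsFirstMin f i → IsFirstMin f j → i ≡ j
firstMin-unique (i-min , i-first) (j-min , j-first) = ≤-antisym (i-first _ (j-min _)) (j-first _ (i-min _))

argmin : ∀ {K} → (Fin (suc K) → ℕ) → Fin (suc K)
argmin {zero} f = fzero
argmin {suc K} f with f fzero ≤? f (fsuc (argmin (λ l → f (fsuc l))))
... | yes _ = fzero
... | no _ = fsuc (argmin (λ l → f (fsuc l)))

argmin-firstMin : ∀ {K} (f : Fin (suc K) → ℕ) → IsFirstMin f (argmin f)
argmin-firstMin {zero} f = (λ { fzero → ℕ.≤-refl }) , λ { fzero _ → z≤n }
argmin-firstMin {suc K} f with f fzero ≤? f (fsuc (argmin (λ l → f (fsuc l))))
    | argmin-firstMin (λ l → f (fsuc l))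
... | yes f0≤ | tail-min , _ =
  (λ { fzero → ℕ.≤-refl ; (fsuc l) → ℕ.≤-trans f0≤ (tail-min l) }) , λ _ _ → z≤n
... | no f0≰ | tail-min , tail-first =
  (λ { fzero → ℕ.<⇒≤ (ℕ.≰⇒> f0≰) ; (fsuc l) → tail-min l }) ,
  λ { fzero f0≤ → ⊥-elim (f0≰ f0≤) ; (fsuc l) fl≤ → s≤s (tail-first l fl≤) }

ShatteredWithin : ∀ {m K} → Graph m → (Fin K → Fin m) → ℕ → Set
ShatteredWithin {m} {K} G X B =
  ∀ (i j : Fin K) → i ≢ j → Σ (Fin m) λ v → Σ ℕ λ r → r ≤ B ×
    (∀ (l : Fin K) → InBall G v r (X l) ⇔ (l ≡ i ⊎ l ≡ j))

-- The Voronoi cells of X, clipped at radius B: w lies in the cell of the nearest point of X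
-- (the first one, on ties), provided it is at distance at most B.
module VoronoiCells {m : ℕ} (G : Graph m) (adj? : ∀ x y → Dec (Adj G x y)) (B : ℕ)
                    {K : ℕ} (X : Fin (suc K) → Fin m) (X-injective : Injective _≡_ _≡_ X) where
  open TruncatedDistance G adj? B

  toX : Fin m → Fin (suc K) → ℕ
  toX w l = dist w (X l)

  centre : Fin m → Fin (suc K)
  centre w = argmin (toX w)

  cell : Fin m → Maybe (Fin (suc K))
  cell w with toX w (centre w) ≤? B
  ... | yes _ = just (centre w)
  ... | no _ = nothing

  depth : Fin m → ℕ
  depth w = toX w (centre w)

  cell-intro : ∀ w i → toX w i ≤ B → IsFirstMin (toX w) i → cell w ≡ just i
  cell-intro w i ≤B i-first with firstMin-unique (argmin-firstMin (toX w)) i-first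
  ... | refl with toX w (centre w) ≤? B
  ...   | yes _ = refl
  ...   | no ≰B = ⊥-elim (≰B ≤B)

  cell-elim : ∀ w i → cell w ≡ just i → centre w ≡ i × toX w i ≤ B × IsFirstMin (toX w) i
  cell-elim w i e with toX w (centre w) ≤? B
  cell-elim w i refl | yes ≤B = refl , ≤B , argmin-firstMin (toX w)
  cell-elim w i () | no _

  depth-cell : ∀ w i → cell w ≡ just i → depth w ≡ toX w i
  depth-cell w i e = cong (toX w) (proj₁ (cell-elim w i e))

  -- X i is the unique point of X at distance 0 from itself, so it lies in cell i
  cell-X : ∀ i → cell (X i) ≡ just i
  cell-X i = cell-intro (X i) i (subst (_≤ B) (sym (dist-self (X i))) z≤n) (nearest , first)
    where
    nearest : ∀ l → toX (X i) i ≤ toX (X i) l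
    nearest l = subst (_≤ toX (X i) l) (sym (dist-self (X i))) z≤n
    first : ∀ l → toX (X i) l ≤ toX (X i) i → i ≤ᶠ l
    first l ≤0 = ≤ᶠ-reflexive
      (X-injective (dist-zero (X i) (X l) (ℕ.n≤0⇒n≡0 (subst (toX (X i) l ≤_) (dist-self (X i)) ≤0))))

  cell-inherit : ∀ w u i → cell w ≡ just i → Adj G w u → suc (toX u i) ≤ toX w i → cell u ≡ just i
  cell-inherit w u i e adj closer with cell-elim w i e
  ... | _ , ≤B , w-min , w-first =
    cell-intro u i (ℕ.≤-trans (ℕ.n≤1+n _) (ℕ.≤-trans closer ≤B)) (u-min , u-first)
    where
    u-min : ∀ l → toX u i ≤ toX u l
    u-min l = ℕ.≤-pred (ℕ.≤-trans closer (ℕ.≤-trans (w-min l) (dist-step w u (X l) adj)))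
    u-first : ∀ l → toX u l ≤ toX u i → i ≤ᶠ l
    u-first l ≤i = w-first l (ℕ.≤-trans (dist-step w u (X l) adj) (ℕ.≤-trans (s≤s ≤i) closer))

  -- The first step of a shortest path from w to its centre stays in the cell and gets closer.
  cell-descend : ∀ w i → cell w ≡ just i → w ≢ X i →
                 Σ (Fin m) λ u → Adj G w u × cell u ≡ just i × depth u < depth w
  cell-descend w i e w≢Xi with cell-elim w i e
  ... | _ , ≤B , _ with dist-walk w (X i) ≤B
  ...   | zero , _ , [] = ⊥-elim (w≢Xi refl)
  ...   | suc j , j<d , _∷_ {y = u} adj W = u , adj , u-cell , depth-lt
    where
    closer : suc (toX u i) ≤ toX w i
    closer = ℕ.≤-trans (s≤s (dist-minimal u (X i) j j≤B (j , ℕ.≤-refl , W))) j<d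
      where
      j≤B : j ≤ B
      j≤B = ℕ.≤-trans (ℕ.n≤1+n j) (ℕ.≤-trans j<d ≤B)
    u-cell : cell u ≡ just i
    u-cell = cell-inherit w u i e adj closer
    depth-lt : depth u < depth w
    depth-lt = subst₂ _<_ (sym (depth-cell u i u-cell)) (sym (depth-cell w i e)) closer

  -- If the ball B(v,r), r ≤ B, meets X only in X i and X j, then every vertex x on a v–X t
  -- walk of length at most r lies in cell i or cell j: the centre of x is as close as X t,
  -- so it is in the ball as well.
  ball-cells : ∀ {v r i j} → r ≤ B → (∀ l → InBall G v r (X l) → l ≡ i ⊎ l ≡ j) →
               ∀ {x s a t} → Walk G v x s → Walk G x (X t) a → s + a ≤ r →
               cell x ≡ just i ⊎ cell x ≡ just j
  ball-cells {v} {r} {i} {j} r≤B inside {x} {s} {a} {t} V U s+a≤r =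
    Sum.map cell-at cell-at (inside (centre x) in-ball)
    where
    a≤B : a ≤ B
    a≤B = ℕ.≤-trans (ℕ.m≤n+m a s) (ℕ.≤-trans s+a≤r r≤B)
    centre≤a : toX x (centre x) ≤ a
    centre≤a = ℕ.≤-trans (proj₁ (argmin-firstMin (toX x)) t)
                         (dist-minimal x (X t) a a≤B (a , ℕ.≤-refl , U))
    in-ball : InBall G v r (X (centre x))
    in-ball = DistLe-mono ((s , ℕ.≤-refl , V) ++ᴰ dist-walk x (X (centre x)) (ℕ.≤-trans centre≤a a≤B))
                          (ℕ.≤-trans (ℕ.+-monoʳ-≤ s centre≤a) s+a≤r)
    cell-at : ∀ {c} → centre x ≡ c → cell x ≡ just c
    cell-at refl = cell-intro x (centre x) (ℕ.≤-trans centre≤a a≤B) (argmin-firstMin (toX x))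

  walk-cells : ∀ {v r i j} → r ≤ B → (∀ l → InBall G v r (X l) → l ≡ i ⊎ l ≡ j) →
               ∀ {t a} (W : Walk G v (X t) a) → a ≤ r →
               ∀ y → y ∈ᵂ W → cell y ≡ just i ⊎ cell y ≡ just j
  walk-cells r≤B inside W a≤r y y∈W with split W y∈W
  ... | s , a′ , V , U , s+a′≡a = ball-cells r≤B inside V U (subst (_≤ _) (sym s+a′≡a) a≤r)

  X-other-cell : ∀ {i j} → i ≢ j → cell (X j) ≢ just i
  X-other-cell i≢j Xj∈i = i≢j (just-injective (trans (sym Xj∈i) (cell-X _)))

  -- If B(v,r), r ≤ B, meets X exactly in X i and X j, then cells i and j are adjacent: walks
  -- from v to X i and to X j of length ≤ r stay in cells i ∪ j, and one of them leaves the cell of v.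
  ball-touch : ∀ {v r i j} → i ≢ j → r ≤ B → (∀ l → InBall G v r (X l) → l ≡ i ⊎ l ≡ j) →
               InBall G v r (X i) → InBall G v r (X j) →
               Σ (Fin m) λ a → Σ (Fin m) λ b → cell a ≡ just i × cell b ≡ just j × Adj G a b
  ball-touch i≢j r≤B inside (_ , aᵢ≤r , Wᵢ) (_ , aⱼ≤r , Wⱼ)
      with walk-cells r≤B inside Wᵢ aᵢ≤r _ (start-∈ᵂ Wᵢ)
  ... | inj₁ v∈i = crossing Wⱼ (walk-cells r≤B inside Wⱼ aⱼ≤r) v∈i (X-other-cell i≢j)
  ... | inj₂ v∈j with crossing Wᵢ (λ y y∈W → Sum.swap (walk-cells r≤B inside Wᵢ aᵢ≤r y y∈W)) v∈j
                              (X-other-cell (λ j≡i → i≢j (sym j≡i)))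
  ...   | a , b , a∈j , b∈i , adj = b , a , b∈i , a∈j , Graph.sym G adj

  cell-touch : ShatteredWithin G X B → ∀ i j → i ≢ j → Σ (Fin m) λ a → Σ (Fin m) λ b →
               cell a ≡ just i × cell b ≡ just j × Adj G a b
  cell-touch shattered i j i≢j with shattered i j i≢j
  ... | v , r , r≤B , trace =
    ball-touch i≢j r≤B (λ l → Equivalence.to (trace l))
      (Equivalence.from (trace i) (inj₁ refl)) (Equivalence.from (trace j) (inj₂ refl))

  voronoiModel : ShatteredWithin G X B → MinorModel G (suc K)
  voronoiModel shattered = record
    { label = cell ; height = depth ; root = X ; root-label = cell-X
    ; descend = cell-descend ; touch = cell-touch shattered }

bounded-choice : ∀ {k} {P : Fin k → ℕ → Set} → (∀ i → Σ ℕ (P i)) →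
                 Σ ℕ λ B → ∀ i → Σ ℕ λ r → r ≤ B × P i r
bounded-choice {zero} _ = 0 , λ ()
bounded-choice {suc k} choose with bounded-choice (λ i → choose (fsuc i))
... | B , rest = proj₁ (choose fzero) ⊔ B , λ
  { fzero → proj₁ (choose fzero) , ℕ.m≤m⊔n _ B , proj₂ (choose fzero)
  ; (fsuc i) → let (r , r≤B , p) = rest i in r , ℕ.≤-trans r≤B (ℕ.m≤n⊔m _ B) , p }

shattered-within : ∀ {m K} {G : Graph m} {X : Fin K → Fin m} → TwoShattered G X → Σ ℕ (ShatteredWithin G X)
shattered-within {m} {K} {G} {X} shattered with bounded-choice (λ i → bounded-choice (separating-radius i))
  where
  Separating : Fin K → Fin K → ℕ → Set
  Separating i j r = i ≢ j → Σ (Fin m) λ v → ∀ l → InBall G v r (X l) ⇔ (l ≡ i ⊎ l ≡ j)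
  separating-radius : ∀ i j → Σ ℕ (Separating i j)
  separating-radius i j with i ≟ j
  ... | yes i≡j = 0 , λ i≢j → ⊥-elim (i≢j i≡j)
  ... | no i≢j = let (v , r , trace) = shattered i j i≢j in r , λ _ → v , trace
... | B , bound = B , within
  where
  within : ShatteredWithin G X B
  within i j i≢j with bound i
  ... | Bᵢ , Bᵢ≤B , boundᵢ with boundᵢ j
  ...   | r , r≤Bᵢ , separating =
    let (v , trace) = separating i≢j in v , r , ℕ.≤-trans r≤Bᵢ Bᵢ≤B , trace

¬¬-∀-Fin : ∀ {n} {P : Fin n → Set} → (∀ i → ¬ ¬ P i) → ¬ ¬ (∀ i → P i)
¬¬-∀-Fin {zero} _ no-∀ = no-∀ λ ()
¬¬-∀-Fin {suc n} ¬¬P no-∀ =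
  ¬¬P fzero λ P0 → ¬¬-∀-Fin (λ i → ¬¬P (fsuc i)) λ Psuc →
    no-∀ λ { fzero → P0 ; (fsuc i) → Psuc i }

-- Adjacency is not decidable in general, but it is not not decidable.
¬¬-adjacency? : ∀ {m} (G : Graph m) → ¬ ¬ (∀ x y → Dec (Adj G x y))
¬¬-adjacency? G = ¬¬-∀-Fin λ x → ¬¬-∀-Fin λ y → ¬¬-excluded-middle

shattered⇒model : ∀ {n m K} {G : Graph n} {G′ : Graph m} → InducedSubgraph G′ G →
                  (∀ x y → Dec (Adj G′ x y)) →
                  (X : Fin (suc K) → Fin m) → Injective _≡_ _≡_ X → TwoShattered G′ X →
                  MinorModel G (suc K)
shattered⇒model {G′ = G′} G′⊆G adj? X X-injective shattered =
  let (B , within) = shattered-within shattered in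
  extendModel G′⊆G (VoronoiCells.voronoiModel G′ adj? B X X-injective within)

theorem4 : (d : ℕ) → 1 ≤ d → {n : ℕ} (G : Graph n) →
    ¬ HasCompleteMinor d G →
    {m : ℕ} (G' : Graph m) → InducedSubgraph G' G →
    {k : ℕ} (X : Fin k → Fin m) → Injective _≡_ _≡_ X →
    TwoShattered G' X → k ≤ d ∸ 1
theorem4 _ _ _ _ _ _ {zero} _ _ _ = z≤n
theorem4 d _ G no-minor G′ G′⊆G {suc K} X X-injective shattered with suc K ≤? d ∸ 1
... | yes small = small
... | no large = ⊥-elim (¬¬-adjacency? G′ λ adj? →
  no-minor (model⇒completeMinor d (shattered⇒model G′⊆G adj? X X-injective shattered) d≤k))
  where
  d≤k : d ≤ suc K
  d≤k = ℕ.≤-trans (ℕ.m≤n+m∸n d 1) (ℕ.≰⇒> large)
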